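{- Let $(G,F,\mathcal{C})$ be a framework and let $C_1,C_2\in\mathcal{C}$ be distinct. Then $|E(C_1\cap C_2)|\le 2$, and if equality holds then either (a) $C_1,C_2$ are both circuits, and $C_1\cap C_2$ is a two-edge path whose middle vertex $v$ lies in $V(F)$ and has degree one in $F$; or (b) $C_1,C_2$ are both paths with the same end-edges $e,f$, $C_1\cap C_2$ consists of the disjoint edges $e,f$ and their ends, and $C_1,C_2$ are disjoint from $F$.
   Context: All graphs are finite and simple; paths and circuits have no repeated vertices. The ends of a path are its first and last vertices, its end-edges its first and last edges. For a set of edges $E'$, $G\setminus E'$ is obtained from $G$ by deleting those edges (keeping all vertices). For a path or circuit $C$, a sequence of vertices/edges is "in order" in $C$ if they are met in that order traversing $C$ (from one end if $C$ is a path; from some starting point if $C$ is a circuit). A framework is a triple $(G,F,\mathcal{C})$ where $G$ is cubic, $F$ is a subgraph of $G$, and $\mathcal{C}$ is a set of subgraphs of $G\setminus E(F)$, satisfying (F1)–(F7) below. Distinct edges $e,f$ are twinned if there exist distinct $C_1,C_2\in\mathcal{C}$ with $e,f\in E(C_1\cap C_2)$. (F1) Each member of $\mathcal{C}$ is an induced subgraph of $G\setminus E(F)$, has at least three edges, and is a path or a circuit. (F2) Every edge of $G\setminus E(F)$ belongs to some member of $\mathcal{C}$, and for every two edges $e,f$ of $G$ with a common end not in $V(F)$ there exists $C\in\mathcal{C}$ with $e,f\in E(C)$. (F3) If $C_1,C_2\in\mathcal{C}$ are distinct and $v\in V(C_1\cap C_2)$, then either $V(C_1\cap C_2)=\{v\}$,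 or $v$ is incident with an edge of $C_1\cap C_2$, or $v\in V(F)$. (F4) If $C_1\in\mathcal{C}$ is a path, every member of $\mathcal{C}$ containing an end-edge of $C_1$ is a path; and if $C_2\in\mathcal{C}\setminus\{C_1\}$ is also a path, then every component of $C_1\cap C_2$ contains an end of $C_1$, and every edge of $C_1\cap C_2$ is an end-edge of $C_1$. (F5) If $C\in\mathcal{C}$ is a circuit then $|V(C\cap F)|\le 1$ and every vertex of $C\cap F$ has degree 1 in $F$; if $C\in\mathcal{C}$ is a path then every vertex of $C\cap F$ is an end of $C$ and has degree 0 or 2 in $F$. (F6) If $e,f$ are twinned and $C\in\mathcal{C}$ with $e\in E(C)$, then $|V(C)|\le 6$ and either: $f\in E(C)$, $C$ is a circuit, $e,f$ have a common end in $V(F)$, and no path in $\mathcal{C}$ contains any vertex of $e$ or $f$; or $f\in E(C)$, $C$ is a path with end-edges $e,f$, and $C\cap F$ is null; or $f\notin E(C)$, $C$ is a path with $|E(C)|=3$, $e$ is an end-edge of $C$, and no end of $e$ is in $V(F)$. (F7) Let $C\in\mathcal{C}$ be a path of length five with twinned end-edges $e,f$. Then $|E(C')|\le 4$ for every path $C'\in\mathcal{C}\setminus\{C\}$ containing $e$. Moreover, let $C$ have vertices $v_0,v_1,\dots,v_5$ in order; then there exists $C'\in\mathcal{C}$ with end-edges $e$ and $f$ and with ends $v_0$ and $v_4$. -}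

module Defs where

open import Data.Nat using (ℕ; zero; suc; _+_; _≤_; _<ᵇ_)
open import Data.Bool using (Bool; true; false; _∧_; not; if_then_else_)
open import Data.Fin using (Fin; toℕ) renaming (zero to fzero; suc to fsuc)
open import Data.List using (List; []; _∷_; _++_; length)
open import Data.List.Membership.Propositional using (_∈_)
open import Data.List.Relation.Unary.Unique.Propositional using (Unique)
open import Data.Product using (Σ; ∃; ∃-syntax; _×_; _,_)
open import Data.Sum using (_⊎_)
open import Relation.Binary.PropositionalEquality using (_≡_; _≢_)
open import Relation.Nullary using (¬_)

sumF : ∀ {n} → (Fin n → ℕ) → ℕ
sumF {zero}  f = 0
sumF {suc n} f = f fzero + sumF (λ i → f (fsuc i))

countF : ∀ {n} → (Fin n → Bool) → ℕ
countF f = sumF (λ i → if f i then 1 else 0)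

_⇔_ : Set → Set → Set
A ⇔ B = (A → B) × (B → A)

-- Subgraphs of a graph on vertex set Fin n: a vertex set and an
-- (unordered, hence symmetric) edge relation.  Graphs themselves are
-- also represented this way (with all vertices present).

record Sub (n : ℕ) : Set where
  constructor mkSub
  field
    vs : Fin n → Bool
    es : Fin n → Fin n → Bool
open Sub public

-- an edge is given by its two ends (unordered)
Edge : ℕ → Set
Edge n = Fin n × Fin n

SameEdge : ∀ {n} → Edge n → Edge n → Set
SameEdge (a , b) (c , d) = (a ≡ c × b ≡ d) ⊎ (a ≡ d × b ≡ c)

EndOf : ∀ {n} → Fin n → Edge n → Set
EndOf x (a , b) = x ≡ a ⊎ x ≡ b

InV : ∀ {n} → Sub n → Fin n → Set
InV H v = vs H v ≡ true

InE : ∀ {n} → Sub n → Edge n → Set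
InE H (a , b) = es H a b ≡ true

SameSub : ∀ {n} → Sub n → Sub n → Set
SameSub H K = (∀ v → vs H v ≡ vs K v) × (∀ u v → es H u v ≡ es K u v)

_∩_ : ∀ {n} → Sub n → Sub n → Sub n
H ∩ K = mkSub (λ v → vs H v ∧ vs K v) (λ u v → es H u v ∧ es K u v)

_∖E_ : ∀ {n} → Sub n → Sub n → Sub n
G ∖E F = mkSub (vs G) (λ u v → es G u v ∧ not (es F u v))

deg : ∀ {n} → Sub n → Fin n → ℕ
deg H v = countF (λ u → es H v u)

vertexCount : ∀ {n} → Sub n → ℕ
vertexCount H = countF (vs H)

-- number of (unordered) edges: count pairs u < v
edgeCount : ∀ {n} → Sub n → ℕ
edgeCount H = sumF (λ u → countF (λ v → (toℕ u <ᵇ toℕ v) ∧ es H u v))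

SimpleGraph : ∀ {n} → Sub n → Set
SimpleGraph G = (∀ v → vs G v ≡ true)
              × (∀ u v → es G u v ≡ es G v u)
              × (∀ v → es G v v ≡ false)

Cubic : ∀ {n} → Sub n → Set
Cubic G = ∀ v → deg G v ≡ 3

-- H is a subgraph of K
IsSubgraph : ∀ {n} → Sub n → Sub n → Set
IsSubgraph K H = (∀ v → InV H v → InV K v)
               × (∀ u v → es H u v ≡ true → es K u v ≡ true)
               × (∀ u v → es H u v ≡ true → InV H u)
               × (∀ u v → es H u v ≡ es H v u)

-- H is an induced subgraph of K
Induced : ∀ {n} → Sub n → Sub n → Set
Induced K H = IsSubgraph K H
            × (∀ u v → InV H u → InV H v → es K u v ≡ true → es H u v ≡ true)

data Consec {n : ℕ} : List (Fin n) → Fin n → Fin n → Set where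
  here  : ∀ {u v rest} → Consec (u ∷ v ∷ rest) u v
  there : ∀ {w rest u v} → Consec rest u v → Consec (w ∷ rest) u v

close : ∀ {n} → List (Fin n) → List (Fin n)
close []       = []
close (x ∷ xs) = x ∷ (xs ++ (x ∷ []))

PathSeq : ∀ {n} → Sub n → List (Fin n) → Set
PathSeq H l = (l ≢ [])
            × Unique l
            × (∀ v → InV H v ⇔ (v ∈ l))
            × (∀ u v → InE H (u , v) ⇔ (Consec l u v ⊎ Consec l v u))

CircSeq : ∀ {n} → Sub n → List (Fin n) → Set
CircSeq H l = (3 ≤ length l)
            × Unique l
            × (∀ v → InV H v ⇔ (v ∈ l))
            × (∀ u v → InE H (u , v) ⇔ (Consec (close l) u v ⊎ Consec (close l) v u))

IsPath : ∀ {n} → Sub n → Set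
IsPath H = ∃[ l ] PathSeq H l

IsCircuit : ∀ {n} → Sub n → Set
IsCircuit H = ∃[ l ] CircSeq H l

-- v is an end (first or last vertex) of the path H
-- (the last vertex is the first vertex of the reversed sequence)
End : ∀ {n} → Sub n → Fin n → Set
End H v = ∃[ rest ] PathSeq H (v ∷ rest)

EndEdge : ∀ {n} → Sub n → Edge n → Set
EndEdge H (a , b) = ∃[ rest ] (PathSeq H (a ∷ b ∷ rest) ⊎ PathSeq H (b ∷ a ∷ rest))

data Reach {n : ℕ} (H : Sub n) : Fin n → Fin n → Set where
  stop : ∀ {x} → InV H x → Reach H x x
  step : ∀ {x y z} → es H x y ≡ true → Reach H y z → Reach H x z

-- Frameworks.  The family 𝒞 is given as an indexed family Fin m → Sub n;
-- "distinct members" means distinct subgraphs (¬ SameSub).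

module _ {n m : ℕ} (G F : Sub n) (𝒞 : Fin m → Sub n) where

  Distinct : Fin m → Fin m → Set
  Distinct i j = ¬ SameSub (𝒞 i) (𝒞 j)

  Twinned : Edge n → Edge n → Set
  Twinned e f = ¬ SameEdge e f
              × ∃[ i ] ∃[ j ] (Distinct i j
                  × InE (𝒞 i) e × InE (𝒞 i) f × InE (𝒞 j) e × InE (𝒞 j) f)

  F1 : Set
  F1 = ∀ i → Induced (G ∖E F) (𝒞 i)
           × 3 ≤ edgeCount (𝒞 i)
           × (IsPath (𝒞 i) ⊎ IsCircuit (𝒞 i))

  F2 : Set
  F2 = (∀ a b → InE (G ∖E F) (a , b) → ∃[ i ] InE (𝒞 i) (a , b))
     × (∀ x u w → InE G (x , u) → InE G (x , w) → u ≢ w → vs F x ≡ false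
          → ∃[ i ] (InE (𝒞 i) (x , u) × InE (𝒞 i) (x , w)))

  F3 : Set
  F3 = ∀ i j → Distinct i j → ∀ v → InV (𝒞 i ∩ 𝒞 j) v →
         (∀ w → InV (𝒞 i ∩ 𝒞 j) w → w ≡ v)
         ⊎ (∃[ u ] InE (𝒞 i ∩ 𝒞 j) (v , u))
         ⊎ InV F v

  F4 : Set
  F4 = ∀ i → IsPath (𝒞 i) →
         (∀ j a b → EndEdge (𝒞 i) (a , b) → InE (𝒞 j) (a , b) → IsPath (𝒞 j))
         × (∀ j → Distinct i j → IsPath (𝒞 j) →
              (∀ x → InV (𝒞 i ∩ 𝒞 j) x →
                 ∃[ y ] (Reach (𝒞 i ∩ 𝒞 j) x y × End (𝒞 i) y))
              × (∀ a b → InE (𝒞 i ∩ 𝒞 j) (a , b) → EndEdge (𝒞 i) (a , b)))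

  F5 : Set
  F5 = ∀ i →
         (IsCircuit (𝒞 i) →
            vertexCount (𝒞 i ∩ F) ≤ 1
            × (∀ v → InV (𝒞 i ∩ F) v → deg F v ≡ 1))
         × (IsPath (𝒞 i) →
            ∀ v → InV (𝒞 i ∩ F) v → End (𝒞 i) v × (deg F v ≡ 0 ⊎ deg F v ≡ 2))

  F6 : Set
  F6 = ∀ e f → Twinned e f → ∀ i → InE (𝒞 i) e →
         vertexCount (𝒞 i) ≤ 6
         × ( (InE (𝒞 i) f × IsCircuit (𝒞 i)
               × (∃[ x ] (EndOf x e × EndOf x f × InV F x))
               × (∀ k → IsPath (𝒞 k) → ∀ x → (EndOf x e ⊎ EndOf x f)
                    → vs (𝒞 k) x ≡ false))
           ⊎ (InE (𝒞 i) f × IsPath (𝒞 i) × EndEdge (𝒞 i) e × EndEdge (𝒞 i) f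
               × (∀ x → InV (𝒞 i) x → vs F x ≡ false))
           ⊎ (es (𝒞 i) (Data.Product.proj₁ f) (Data.Product.proj₂ f) ≡ false
               × IsPath (𝒞 i) × edgeCount (𝒞 i) ≡ 3 × EndEdge (𝒞 i) e
               × (∀ x → EndOf x e → vs F x ≡ false)))

  F7 : Set
  F7 = ∀ i (v₀ v₁ v₂ v₃ v₄ v₅ : Fin n) →
         PathSeq (𝒞 i) (v₀ ∷ v₁ ∷ v₂ ∷ v₃ ∷ v₄ ∷ v₅ ∷ []) →
         Twinned (v₀ , v₁) (v₄ , v₅) →
         (∀ j → Distinct j i → IsPath (𝒞 j) → InE (𝒞 j) (v₀ , v₁)
              → edgeCount (𝒞 j) ≤ 4)
         × (∃[ j ] (EndEdge (𝒞 j) (v₀ , v₁) × EndEdge (𝒞 j) (v₄ , v₅)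
                    × End (𝒞 j) v₀ × End (𝒞 j) v₄))

  record Framework : Set where
    field
      simple   : SimpleGraph G
      cubic    : Cubic G
      F-sub    : IsSubgraph G F
      𝒞-sub    : ∀ i → IsSubgraph (G ∖E F) (𝒞 i)
      f1 : F1
      f2 : F2
      f3 : F3
      f4 : F4
      f5 : F5
      f6 : F6
      f7 : F7

module Submission where

-- If X = C₁ ∩ C₂ has two distinct edges e, f, they are twinned, so
-- (F6) says that in each Cₖ they are either two edges of a circuit at a vertex
-- of F, or the two end-edges of a path avoiding F; by (F6) again the two
-- members are of the same kind.  A third edge g of X would be twinned with e,
-- and (F6) would make e, f, g three edges of a circuit at the unique (F5)
-- vertex of F, or three end-edges of a path -- both impossible.  Hence X has
-- exactly the edges e, f, and by (F3) its vertices are their ends; this gives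
-- the two outcomes, disjointness of e and f coming from (F1).

open import Defs
open import Data.Nat using (ℕ; zero; suc; _+_; _≤_; _<ᵇ_; z≤n; s≤s)
open import Data.Nat.Properties
  using (≤-trans; ≤-reflexive; +-mono-≤; +-monoʳ-≤; +-comm; m≤m+n; m≤n+m; n≤1+n; +-commutativeSemigroup)
open import Algebra.Properties.CommutativeSemigroup +-commutativeSemigroup using (interchange)
open import Data.Bool using (Bool; true; false; _∧_; not; if_then_else_)
import Data.Bool.Properties as Bool
open import Data.Fin using (Fin; toℕ; _≟_) renaming (zero to fzero; suc to fsuc)
open import Data.Fin.Properties using (any?)
open import Data.List using (List; []; _∷_; _∷ʳ_; length; map)
open import Data.List.Properties using (length-map; ∷ʳ-injective; ∷-injective)
open import Data.List.Membership.Propositional using (_∈_)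
open import Data.List.Relation.Unary.Any as Any using (Any; here; there)
import Data.List.Relation.Unary.Any.Properties as Any
open import Data.List.Relation.Unary.All using ([]; _∷_)
open import Data.List.Relation.Unary.All.Properties using (All¬⇒¬Any)
open import Data.List.Relation.Unary.AllPairs using ([]; _∷_)
open import Data.List.Relation.Unary.Unique.Propositional using (Unique)
import Data.List.Relation.Unary.Unique.Propositional.Properties as Unique
open import Data.Product using (∃-syntax; _×_; _,_; proj₁; proj₂; map₂)
open import Data.Sum using (_⊎_; inj₁; inj₂)
import Data.Sum as Sum
open import Data.Empty using (⊥; ⊥-elim)
open import Relation.Binary.PropositionalEquality
open import Relation.Nullary using (¬_; yes; no; Dec; does; contradiction)
open import Relation.Nullary.Decidable using (_×-dec_; _⊎-dec_; ¬?; dec-true; decidable-stable)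

-- Counting.  countF f = sumF (ind ∘ f) definitionally.

ind : Bool → ℕ
ind b = if b then 1 else 0

sumF-mono : ∀ {n} {f g : Fin n → ℕ} → (∀ i → f i ≤ g i) → sumF f ≤ sumF g
sumF-mono {zero}  le = z≤n
sumF-mono {suc n} le = +-mono-≤ (le fzero) (sumF-mono (λ i → le (fsuc i)))

sumF-+ : ∀ {n} (f g : Fin n → ℕ) → sumF (λ i → f i + g i) ≡ sumF f + sumF g
sumF-+ {zero}  f g = refl
sumF-+ {suc n} f g =
  trans (cong (f fzero + g fzero +_) (sumF-+ (λ i → f (fsuc i)) (λ i → g (fsuc i))))
        (interchange (f fzero) (g fzero) _ _)

sumF-zero : ∀ {n} → sumF {n} (λ _ → 0) ≡ 0
sumF-zero {zero}  = refl
sumF-zero {suc n} = sumF-zero {n}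

sumF-≤0 : ∀ {n} {f : Fin n → ℕ} → (∀ i → f i ≤ 0) → sumF f ≤ 0
sumF-≤0 {n} le = ≤-trans (sumF-mono le) (≤-reflexive (sumF-zero {n}))

sumF-point : ∀ {n} (a : Fin n) → sumF (λ i → ind (does (i ≟ a))) ≡ 1
sumF-point {suc n} fzero    = cong suc (sumF-zero {n})
sumF-point {suc n} (fsuc a) = sumF-point a

sumF-≥-term : ∀ {n} (f : Fin n → ℕ) x → f x ≤ sumF f
sumF-≥-term f fzero    = m≤m+n _ _
sumF-≥-term f (fsuc x) = ≤-trans (sumF-≥-term (λ i → f (fsuc i)) x) (m≤n+m _ _)

sumF-≥-pair : ∀ {n} (f : Fin n → ℕ) {x y} → x ≢ y → f x + f y ≤ sumF f
sumF-≥-pair f {fzero}  {fzero}  x≢y = contradiction refl x≢y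
sumF-≥-pair f {fzero}  {fsuc y} x≢y = +-monoʳ-≤ (f fzero) (sumF-≥-term (λ i → f (fsuc i)) y)
sumF-≥-pair f {fsuc x} {fzero}  x≢y =
  subst (_≤ sumF f) (+-comm (f fzero) _) (sumF-≥-pair f {fzero} {fsuc x} (λ ()))
sumF-≥-pair f {fsuc x} {fsuc y} x≢y =
  ≤-trans (sumF-≥-pair (λ i → f (fsuc i)) (λ x≡y → x≢y (cong fsuc x≡y))) (m≤n+m _ _)

countF-≤1-unique : ∀ {n} (f : Fin n → Bool) → countF f ≤ 1 →
  ∀ {x y} → f x ≡ true → f y ≡ true → x ≡ y
countF-≤1-unique f le {x} {y} fx fy with x ≟ y
... | yes x≡y = x≡y
... | no x≢y with ≤-trans (sumF-≥-pair (λ i → ind (f i)) x≢y) le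
... | two≤one rewrite fx | fy with two≤one
... | s≤s ()

sumF₂ : ∀ {n} → (Fin n → Fin n → ℕ) → ℕ
sumF₂ g = sumF (λ u → sumF (λ v → g u v))

ind-split : ∀ x p → ind x ≤ ind p + ind (x ∧ not p)
ind-split true  true  = s≤s z≤n
ind-split true  false = s≤s z≤n
ind-split false p     = z≤n

sumF₂-split : ∀ {n} {h f g : Fin n → Fin n → ℕ} → (∀ u v → h u v ≤ f u v + g u v) →
  sumF₂ h ≤ sumF₂ f + sumF₂ g
sumF₂-split {f = f} {g} le = ≤-trans
  (sumF-mono (λ u → ≤-trans (sumF-mono (le u)) (≤-reflexive (sumF-+ (f u) (g u)))))
  (≤-reflexive (sumF-+ (λ u → sumF (f u)) (λ u → sumF (g u))))

sumF₂-point : ∀ {n} (a b : Fin n) → sumF₂ (λ u v → ind (does (u ≟ a) ∧ does (v ≟ b))) ≤ 1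
sumF₂-point {n} a b = ≤-trans (sumF-mono row) (≤-reflexive (sumF-point a))
  where
  row : ∀ u → sumF (λ v → ind (does (u ≟ a) ∧ does (v ≟ b))) ≤ ind (does (u ≟ a))
  row u with does (u ≟ a)
  ... | true  = ≤-reflexive (sumF-point b)
  ... | false = ≤-reflexive (sumF-zero {n})

pair-count : ∀ {n} (g : Fin n → Fin n → Bool) (ps : List (Fin n × Fin n)) →
  (∀ u v → g u v ≡ true → (u , v) ∈ ps) → sumF₂ (λ u v → ind (g u v)) ≤ length ps
pair-count g [] g⊆ps = sumF-≤0 (λ u → sumF-≤0 (empty u))
  where
  empty : ∀ u v → ind (g u v) ≤ 0
  empty u v with g u v in eq
  ... | true  with () ← g⊆ps u v eq
  ... | false = z≤n
pair-count g ((a , b) ∷ ps) g⊆ps =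
  ≤-trans (sumF₂-split (λ u v → ind-split (g u v) (δ u v)))
          (+-mono-≤ (sumF₂-point a b) (pair-count g′ ps g′⊆ps))
  where
  δ g′ : _ → _ → Bool
  δ u v = does ((u ≟ a) ×-dec (v ≟ b))
  g′ u v = g u v ∧ not (δ u v)
  g′⊆ps : ∀ u v → g′ u v ≡ true → (u , v) ∈ ps
  g′⊆ps u v eq with g u v in g-eq | δ u v in δ-eq
  ... | true | false with g⊆ps u v g-eq
  ...   | here refl = contradiction (trans (sym (dec-true ((u ≟ a) ×-dec (v ≟ b)) (refl , refl))) δ-eq) (λ ())
  ...   | there m   = m

∧-true⁻ : ∀ {a b} → a ∧ b ≡ true → a ≡ true × b ≡ true
∧-true⁻ {true} b≡true = refl , b≡true

∧-true⁺ : ∀ {a b} → a ≡ true → b ≡ true → a ∧ b ≡ true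
∧-true⁺ refl refl = refl

true≢false : true ≢ false
true≢false ()

module _ {n : ℕ} where

  SameEdge-sym : {e f : Edge n} → SameEdge e f → SameEdge f e
  SameEdge-sym (inj₁ (refl , refl)) = inj₁ (refl , refl)
  SameEdge-sym (inj₂ (refl , refl)) = inj₂ (refl , refl)

  SameEdge-trans : {e f g : Edge n} → SameEdge e f → SameEdge f g → SameEdge e g
  SameEdge-trans (inj₁ (refl , refl)) s = s
  SameEdge-trans (inj₂ (refl , refl)) (inj₁ (refl , refl)) = inj₂ (refl , refl)
  SameEdge-trans (inj₂ (refl , refl)) (inj₂ (refl , refl)) = inj₁ (refl , refl)

  SameEdge? : (e f : Edge n) → Dec (SameEdge e f)
  SameEdge? (a , b) (c , d) = ((a ≟ c) ×-dec (b ≟ d)) ⊎-dec ((a ≟ d) ×-dec (b ≟ c))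

  EndOf-resp : ∀ {x} {e f : Edge n} → SameEdge e f → EndOf x e → EndOf x f
  EndOf-resp (inj₁ (refl , refl)) x∈e = x∈e
  EndOf-resp (inj₂ (refl , refl)) x∈e = Sum.swap x∈e

  other-end : ∀ {x} {e : Edge n} → EndOf x e → ∃[ o ] SameEdge (x , o) e
  other-end {e = a , b} (inj₁ refl) = b , inj₁ (refl , refl)
  other-end {e = a , b} (inj₂ refl) = a , inj₂ (refl , refl)

  distinct-resp : ∀ {e f e′ f′ : Edge n} → ¬ SameEdge e f → SameEdge e e′ → SameEdge f f′ →
    ¬ SameEdge e′ f′
  distinct-resp e≢f s s′ e′≡f′ = e≢f (SameEdge-trans s (SameEdge-trans e′≡f′ (SameEdge-sym s′)))

  InE-resp : ∀ (H : Sub n) → (∀ {u v} → InE H (u , v) → InE H (v , u)) →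
    ∀ {e f} → SameEdge e f → InE H e → InE H f
  InE-resp H sym-H (inj₁ (refl , refl)) e∈H = e∈H
  InE-resp H sym-H (inj₂ (refl , refl)) e∈H = sym-H e∈H

-- Counting edges.  edgeCount counts the pairs u < v; every edge has exactly
-- one such orientation.

<ᵇ-asym : ∀ m k → (m <ᵇ k) ≡ true → (k <ᵇ m) ≡ false
<ᵇ-asym zero    (suc k) _   = refl
<ᵇ-asym (suc m) (suc k) m<k = <ᵇ-asym m k m<k

orient : ∀ {n} → Edge n → Fin n × Fin n
orient (a , b) = if toℕ a <ᵇ toℕ b then (a , b) else (b , a)

orient-canonical : ∀ {n} {u v : Fin n} {e} → (toℕ u <ᵇ toℕ v) ≡ true →
  SameEdge (u , v) e → (u , v) ≡ orient e
orient-canonical u<v (inj₁ (refl , refl)) rewrite u<v = refl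
orient-canonical {u = u} {v} u<v (inj₂ (refl , refl))
  rewrite <ᵇ-asym (toℕ u) (toℕ v) u<v = refl

edgeCount-≤ : ∀ {n} (H : Sub n) (l : List (Edge n)) →
  (∀ u v → InE H (u , v) → Any (SameEdge (u , v)) l) → edgeCount H ≤ length l
edgeCount-≤ H l covered =
  subst (edgeCount H ≤_) (length-map orient l) (pair-count oriented (map orient l) oriented⊆)
  where
  oriented : _ → _ → Bool
  oriented u v = (toℕ u <ᵇ toℕ v) ∧ es H u v
  oriented⊆ : ∀ u v → oriented u v ≡ true → (u , v) ∈ map orient l
  oriented⊆ u v eq with ∧-true⁻ {toℕ u <ᵇ toℕ v} eq
  ... | u<v , uv∈H = Any.map⁺ (Any.map (orient-canonical u<v) (covered u v uv∈H))

covered-or-escaping : ∀ {n} (H : Sub n) (l : List (Edge n)) →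
  (∀ u v → InE H (u , v) → Any (SameEdge (u , v)) l)
  ⊎ ∃[ e ] (InE H e × ¬ Any (SameEdge e) l)
covered-or-escaping H l
  with any? (λ u → any? (λ v → (es H u v Bool.≟ true) ×-dec ¬? (Any.any? (SameEdge? (u , v)) l)))
... | yes (u , v , uv∈H , escapes) = inj₂ ((u , v) , uv∈H , escapes)
... | no none = inj₁ λ u v uv∈H →
  decidable-stable (Any.any? (SameEdge? (u , v)) l) (λ escapes → none (u , v , uv∈H , escapes))

at-most-one-or-two-edges : ∀ {n} (H : Sub n) →
  edgeCount H ≤ 1 ⊎ ∃[ e ] ∃[ f ] (InE H e × InE H f × ¬ SameEdge e f)
at-most-one-or-two-edges H with covered-or-escaping H []
... | inj₁ none = inj₁ (≤-trans (edgeCount-≤ H [] none) z≤n)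
... | inj₂ (e , e∈H , _) with covered-or-escaping H (e ∷ [])
...   | inj₁ only-e = inj₁ (edgeCount-≤ H (e ∷ []) only-e)
...   | inj₂ (f , f∈H , f∉[e]) = inj₂ (e , f , e∈H , f∈H , λ e≡f → f∉[e] (here (SameEdge-sym e≡f)))

module _ {n : ℕ} where

  head∉tail : ∀ {x : Fin n} {l} → Unique (x ∷ l) → ¬ x ∈ l
  head∉tail (x∉l ∷ _) = All¬⇒¬Any x∉l

  tail-unique : ∀ {x : Fin n} {l} → Unique (x ∷ l) → Unique l
  tail-unique (_ ∷ u) = u

  consec-fst : ∀ {l : List (Fin n)} {x y} → Consec l x y → x ∈ l
  consec-fst here      = here refl
  consec-fst (there c) = there (consec-fst c)

  consec-snd : ∀ {l : List (Fin n)} {x y} → Consec l x y → y ∈ l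
  consec-snd here      = there (here refl)
  consec-snd (there c) = there (consec-snd c)

  succ-of-head : ∀ {x : Fin n} {l t} → Unique (x ∷ l) → Consec (x ∷ l) x t → ∃[ r ] l ≡ t ∷ r
  succ-of-head u (here {rest = r}) = r , refl
  succ-of-head u (there c)         = contradiction (consec-fst c) (head∉tail u)

  head-no-pred : ∀ {x : Fin n} {l t} → Unique (x ∷ l) → ¬ Consec (x ∷ l) t x
  head-no-pred u here      = head∉tail u (here refl)
  head-no-pred u (there c) = head∉tail u (consec-snd c)

  consec-asym : ∀ {l : List (Fin n)} {a b} → Unique l → Consec l a b → ¬ Consec l b a
  consec-asym u here        c₂        = head-no-pred u c₂
  consec-asym u (there c₁)  here      = head-no-pred u (there c₁)
  consec-asym u (there c₁) (there c₂) = consec-asym (tail-unique u) c₁ c₂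

  succ-or-last : ∀ {l : List (Fin n)} {x} → x ∈ l → (∃[ z ] Consec l x z) ⊎ (∃[ ys ] l ≡ ys ∷ʳ x)
  succ-or-last {a ∷ []}    (here refl) = inj₂ ([] , refl)
  succ-or-last {a ∷ b ∷ l} (here refl) = inj₁ (b , here)
  succ-or-last {a ∷ l}     (there x∈l) with succ-or-last x∈l
  ... | inj₁ (z , c)      = inj₁ (z , there c)
  ... | inj₂ (ys , l≡ys∷ʳx) = inj₂ (a ∷ ys , cong (a ∷_) l≡ys∷ʳx)

  pred-in-cons : ∀ {p : Fin n} {l x} → x ∈ l → ∃[ y ] Consec (p ∷ l) y x
  pred-in-cons {p} (here refl) = p , here
  pred-in-cons {l = a ∷ l} (there x∈l) with pred-in-cons {a} x∈l
  ... | y , c = y , there c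

  consec-init : ∀ (xs : List (Fin n)) {z x y} → Consec (xs ∷ʳ z) x y → x ∈ xs
  consec-init []           (there ())
  consec-init (a ∷ [])     here          = here refl
  consec-init (a ∷ [])     (there (there ()))
  consec-init (a ∷ b ∷ xs) here          = here refl
  consec-init (a ∷ b ∷ xs) (there c)     = there (consec-init (b ∷ xs) c)

  succ-unique : ∀ (xs : List (Fin n)) {z x y y′} → Unique xs →
    Consec (xs ∷ʳ z) x y → Consec (xs ∷ʳ z) x y′ → y ≡ y′
  succ-unique []           u (there ()) _
  succ-unique (a ∷ [])     u here here = refl
  succ-unique (a ∷ [])     u here (there (there ()))
  succ-unique (a ∷ [])     u (there (there ())) _
  succ-unique (a ∷ b ∷ xs) u here       here       = refl
  succ-unique (a ∷ b ∷ xs) u here       (there c)  = contradiction (consec-init (b ∷ xs) c) (head∉tail u)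
  succ-unique (a ∷ b ∷ xs) u (there c)  here       = contradiction (consec-init (b ∷ xs) c) (head∉tail u)
  succ-unique (a ∷ b ∷ xs) u (there c₁) (there c₂) = succ-unique (b ∷ xs) (tail-unique u) c₁ c₂

  pred-unique : ∀ {h : Fin n} {T x y y′} → Unique T →
    Consec (h ∷ T) y x → Consec (h ∷ T) y′ x → y ≡ y′
  pred-unique u here       here       = refl
  pred-unique u here       (there c)  = contradiction c (head-no-pred u)
  pred-unique u (there c)  here       = contradiction c (head-no-pred u)
  pred-unique {T = _ ∷ _} u (there c₁) (there c₂) = pred-unique (tail-unique u) c₁ c₂

  steps : List (Fin n) → List (Edge n)
  steps (x ∷ y ∷ l) = (x , y) ∷ steps (y ∷ l)
  steps _           = []

  consec-step : ∀ {l : List (Fin n)} {x y} → Consec l x y → (x , y) ∈ steps l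
  consec-step                   here      = here refl
  consec-step {_ ∷ _ ∷ _}       (there c) = there (consec-step c)

module _ {n : ℕ} {H : Sub n} where

  consec-sym : ∀ {L : List (Fin n)} → (∀ u v → InE H (u , v) ⇔ (Consec L u v ⊎ Consec L v u)) →
    ∀ {u v} → InE H (u , v) → InE H (v , u)
  consec-sym E {u} {v} uv∈H = proj₂ (E v u) (Sum.swap (proj₁ (E u v) uv∈H))

  path-sym : ∀ {l u v} → PathSeq H l → InE H (u , v) → InE H (v , u)
  path-sym (_ , _ , _ , E) = consec-sym E

  consec-edge : ∀ {l u v} → PathSeq H l → Consec l u v → InE H (u , v)
  consec-edge (_ , _ , _ , E) c = proj₂ (E _ _) (inj₁ c)

  first-edge : ∀ {p q r} → PathSeq H (p ∷ q ∷ r) → InE H (p , q)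
  first-edge P = consec-edge P here

  head-neighbour : ∀ {p q r t} → PathSeq H (p ∷ q ∷ r) → InE H (p , t) → t ≡ q
  head-neighbour (_ , u , _ , E) pt∈H with proj₁ (E _ _) pt∈H
  ... | inj₁ c = sym (proj₁ (∷-injective (proj₂ (succ-of-head u c))))
  ... | inj₂ c = contradiction c (head-no-pred u)

  second-neighbour : ∀ {p q r t} → PathSeq H (p ∷ q ∷ r) → InE H (q , t) → t ≢ p → ∃[ r′ ] r ≡ t ∷ r′
  second-neighbour (_ , u , _ , E) qt∈H t≢p with proj₁ (E _ _) qt∈H
  ... | inj₁ here      = contradiction (here refl) (head∉tail u)
  ... | inj₁ (there c) = succ-of-head (tail-unique u) c
  ... | inj₂ here      = contradiction refl t≢p
  ... | inj₂ (there c) = contradiction c (head-no-pred (tail-unique u))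

  same-start : ∀ {p q r q′ r′} → PathSeq H (p ∷ q ∷ r) → PathSeq H (p ∷ q′ ∷ r′) → q′ ≡ q
  same-start P P′ = head-neighbour P (first-edge P′)

  start-or-last : ∀ {p q r p′ q′ r′} → PathSeq H (p ∷ q ∷ r) → PathSeq H (p′ ∷ q′ ∷ r′) →
    p ≢ p′ → ∃[ ys ] p ∷ q ∷ r ≡ ys ∷ʳ p′
  start-or-last {p} P@(_ , u , V , _) P′@(_ , _ , V′ , _) p≢p′
    with proj₁ (V _) (proj₂ (V′ _) (here refl))
  ... | here p′≡p = contradiction (sym p′≡p) p≢p′
  ... | there p′∈tail with succ-or-last (there p′∈tail)
  ...   | inj₂ last = last
  ...   | inj₁ (z , c) with pred-in-cons {p = p} p′∈tail
  ...     | y , c′ = contradiction (subst (Consec _ _) z≡q′ c) (consec-asym u (subst (λ w → Consec _ w _) y≡q′ c′))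
    where
    z≡q′ = head-neighbour P′ (consec-edge P c)
    y≡q′ = head-neighbour P′ (path-sym P (consec-edge P c′))

  path-edgeCount : ∀ {l} → PathSeq H l → edgeCount H ≤ length (steps l)
  path-edgeCount {l} (_ , _ , _ , E) = edgeCount-≤ H (steps l) λ u v uv∈H → as-step (proj₁ (E u v) uv∈H)
    where
    as-step : ∀ {u v} → Consec l u v ⊎ Consec l v u → Any (SameEdge (u , v)) (steps l)
    as-step (inj₁ c) = Any.map (λ { refl → inj₁ (refl , refl) }) (consec-step c)
    as-step (inj₂ c) = Any.map (λ { refl → inj₂ (refl , refl) }) (consec-step c)

  end-edge-seq : ∀ {e} → EndEdge H e →
    ∃[ p ] ∃[ q ] ∃[ r ] (PathSeq H (p ∷ q ∷ r) × SameEdge e (p , q))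
  end-edge-seq {a , b} (r , inj₁ P) = a , b , r , P , inj₁ (refl , refl)
  end-edge-seq {a , b} (r , inj₂ P) = b , a , r , P , inj₂ (refl , refl)

  distinct-starts : ∀ {p q r p′ q′ r′} → PathSeq H (p ∷ q ∷ r) → PathSeq H (p′ ∷ q′ ∷ r′) →
    ¬ SameEdge (p , q) (p′ , q′) → p ≢ p′
  distinct-starts P P′ ne refl = ne (inj₁ (refl , sym (same-start P P′)))

  at-most-two-end-edges : ∀ {e₁ e₂ e₃} → EndEdge H e₁ → EndEdge H e₂ → EndEdge H e₃ →
    ¬ SameEdge e₁ e₂ → ¬ SameEdge e₁ e₃ → ¬ SameEdge e₂ e₃ → ⊥
  at-most-two-end-edges E₁ E₂ E₃ n₁₂ n₁₃ n₂₃
    with end-edge-seq E₁ | end-edge-seq E₂ | end-edge-seq E₃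
  ... | _ , _ , _ , P₁ , s₁ | _ , _ , _ , P₂ , s₂ | _ , _ , _ , P₃ , s₃
    with start-or-last P₁ P₂ (distinct-starts P₁ P₂ (distinct-resp n₁₂ s₁ s₂))
       | start-or-last P₁ P₃ (distinct-starts P₁ P₃ (distinct-resp n₁₃ s₁ s₃))
  ... | ys , ends-p₂ | ys′ , ends-p₃ =
    distinct-starts P₂ P₃ (distinct-resp n₂₃ s₂ s₃) (proj₂ (∷ʳ-injective ys ys′ (trans (sym ends-p₂) ends-p₃)))

  middle-shared : ∀ {p q r p′ r′} → PathSeq H (p ∷ q ∷ r) → PathSeq H (p′ ∷ q ∷ r′) →
    p ≢ p′ → 3 ≤ edgeCount H → ⊥
  middle-shared P P′ p≢p′ three≤ with second-neighbour P (path-sym P′ (first-edge P′)) (λ p′≡p → p≢p′ (sym p′≡p))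
  ... | [] , refl = contradiction (≤-trans three≤ (path-edgeCount P)) λ { (s≤s (s≤s ())) }
  ... | z ∷ _ , refl = head∉tail (tail-unique (proj₁ (proj₂ P))) (there (here (sym z≡q)))
    where
    z≡q = head-neighbour P′ (consec-edge P (there (there here)))

  first-edges-disjoint : ∀ {p q r p′ q′ r′ x} → PathSeq H (p ∷ q ∷ r) → PathSeq H (p′ ∷ q′ ∷ r′) →
    ¬ SameEdge (p , q) (p′ , q′) → 3 ≤ edgeCount H → EndOf x (p , q) → EndOf x (p′ , q′) → ⊥
  first-edges-disjoint P P′ ne three≤ (inj₁ refl) (inj₁ refl) = distinct-starts P P′ ne refl
  first-edges-disjoint P P′ ne three≤ (inj₁ refl) (inj₂ refl) =
    ne (inj₂ (refl , sym (head-neighbour P (path-sym P′ (first-edge P′)))))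
  first-edges-disjoint P P′ ne three≤ (inj₂ refl) (inj₁ refl) =
    ne (inj₂ (head-neighbour P′ (path-sym P (first-edge P)) , refl))
  first-edges-disjoint {p = p} {p′ = p′} P P′ ne three≤ (inj₂ refl) (inj₂ refl) with p ≟ p′
  ... | yes refl  = ne (inj₁ (refl , refl))
  ... | no p≢p′ = middle-shared P P′ p≢p′ three≤

  end-edges-disjoint : ∀ {e f x} → EndEdge H e → EndEdge H f → ¬ SameEdge e f →
    3 ≤ edgeCount H → EndOf x e → EndOf x f → ⊥
  end-edges-disjoint Eₑ E_f e≢f three≤ x∈e x∈f with end-edge-seq Eₑ | end-edge-seq E_f
  ... | _ , _ , _ , P , s | _ , _ , _ , P′ , s′ =
    first-edges-disjoint P P′ (distinct-resp e≢f s s′) three≤ (EndOf-resp s x∈e) (EndOf-resp s′ x∈f)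

  cherry : ∀ {u v w} {e f : Edge n} → SameEdge (v , u) e → SameEdge (v , w) f →
    u ≢ v → v ≢ w → u ≢ w →
    (∀ y → InV H y ⇔ (EndOf y e ⊎ EndOf y f)) →
    (∀ s t → InE H (s , t) ⇔ (SameEdge (s , t) e ⊎ SameEdge (s , t) f)) →
    PathSeq H (u ∷ v ∷ w ∷ [])
  cherry {u} {v} {w} s₁ s₂ u≢v v≢w u≢w V E =
    (λ ()) , unique , (λ y → vertex-to y , vertex-from y) , (λ s t → edge-to s t , edge-from s t)
    where
    unique : Unique (u ∷ v ∷ w ∷ [])
    unique = (u≢v ∷ u≢w ∷ []) ∷ (v≢w ∷ []) ∷ [] ∷ []
    vertex-to : ∀ y → InV H y → y ∈ u ∷ v ∷ w ∷ []
    vertex-to y y∈H with proj₁ (V y) y∈H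
    ... | inj₁ y∈e with EndOf-resp (SameEdge-sym s₁) y∈e
    ...   | inj₁ refl = there (here refl)
    ...   | inj₂ refl = here refl
    vertex-to y y∈H | inj₂ y∈f with EndOf-resp (SameEdge-sym s₂) y∈f
    ...   | inj₁ refl = there (here refl)
    ...   | inj₂ refl = there (there (here refl))
    vertex-from : ∀ y → y ∈ u ∷ v ∷ w ∷ [] → InV H y
    vertex-from y (here refl)                 = proj₂ (V y) (inj₁ (EndOf-resp s₁ (inj₂ refl)))
    vertex-from y (there (here refl))         = proj₂ (V y) (inj₁ (EndOf-resp s₁ (inj₁ refl)))
    vertex-from y (there (there (here refl))) = proj₂ (V y) (inj₂ (EndOf-resp s₂ (inj₂ refl)))
    edge-to : ∀ s t → InE H (s , t) → Consec (u ∷ v ∷ w ∷ []) s t ⊎ Consec (u ∷ v ∷ w ∷ []) t s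
    edge-to s t st∈H with proj₁ (E s t) st∈H
    ... | inj₁ st≡e with SameEdge-trans st≡e (SameEdge-sym s₁)
    ...   | inj₁ (refl , refl) = inj₂ here
    ...   | inj₂ (refl , refl) = inj₁ here
    edge-to s t st∈H | inj₂ st≡f with SameEdge-trans st≡f (SameEdge-sym s₂)
    ...   | inj₁ (refl , refl) = inj₁ (there here)
    ...   | inj₂ (refl , refl) = inj₂ (there here)
    edge-from : ∀ s t → Consec (u ∷ v ∷ w ∷ []) s t ⊎ Consec (u ∷ v ∷ w ∷ []) t s → InE H (s , t)
    edge-from s t (inj₁ here)         = proj₂ (E s t) (inj₁ (SameEdge-trans (inj₂ (refl , refl)) s₁))
    edge-from s t (inj₁ (there here)) = proj₂ (E s t) (inj₂ s₂)
    edge-from s t (inj₂ here)         = proj₂ (E s t) (inj₁ s₁)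
    edge-from s t (inj₂ (there here)) = proj₂ (E s t) (inj₂ (SameEdge-trans (inj₂ (refl , refl)) s₂))
    edge-from s t (inj₁ (there (there (there ()))))
    edge-from s t (inj₂ (there (there (there ()))))

module _ {n : ℕ} where

  closed-succ-unique : ∀ {h : Fin n} {t x y y′} → Unique (h ∷ t) →
    Consec (close (h ∷ t)) x y → Consec (close (h ∷ t)) x y′ → y ≡ y′
  closed-succ-unique {h} {t} u = succ-unique (h ∷ t) u

  closed-pred-unique : ∀ {h : Fin n} {t x y y′} → Unique (h ∷ t) →
    Consec (close (h ∷ t)) y x → Consec (close (h ∷ t)) y′ x → y ≡ y′
  closed-pred-unique u = pred-unique (Unique.++⁺ (tail-unique u) ([] ∷ []) h∉t)
    where
    h∉t : ∀ {v} → ¬ (v ∈ _ × v ∈ _ ∷ [])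
    h∉t (v∈t , here refl) = head∉tail u v∈t

module _ {n : ℕ} {H : Sub n} where

  -- each neighbour of x is its successor or its predecessor in the closed sequence
  circuit-degree : ∀ {x o₁ o₂ o₃} → IsCircuit H →
    InE H (x , o₁) → InE H (x , o₂) → InE H (x , o₃) → o₁ ≢ o₂ → o₁ ≢ o₃ → o₂ ≢ o₃ → ⊥
  circuit-degree ([] , () , _)
  circuit-degree (h ∷ t , _ , u , _ , E) x₁ x₂ x₃ n₁₂ n₁₃ n₂₃
    with proj₁ (E _ _) x₁ | proj₁ (E _ _) x₂ | proj₁ (E _ _) x₃
  ... | inj₁ s₁ | inj₁ s₂ | _       = n₁₂ (closed-succ-unique u s₁ s₂)
  ... | inj₁ s₁ | inj₂ _  | inj₁ s₃ = n₁₃ (closed-succ-unique u s₁ s₃)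
  ... | inj₁ _  | inj₂ p₂ | inj₂ p₃ = n₂₃ (closed-pred-unique u p₂ p₃)
  ... | inj₂ _  | inj₁ s₂ | inj₁ s₃ = n₂₃ (closed-succ-unique u s₂ s₃)
  ... | inj₂ p₁ | inj₁ _  | inj₂ p₃ = n₁₃ (closed-pred-unique u p₁ p₃)
  ... | inj₂ p₁ | inj₂ p₂ | _       = n₁₂ (closed-pred-unique u p₁ p₂)

  circuit-three-edges : ∀ {x e₁ e₂ e₃} → IsCircuit H →
    InE H e₁ → InE H e₂ → InE H e₃ → EndOf x e₁ → EndOf x e₂ → EndOf x e₃ →
    ¬ SameEdge e₁ e₂ → ¬ SameEdge e₁ e₃ → ¬ SameEdge e₂ e₃ → ⊥
  circuit-three-edges C@(_ , _ , _ , _ , E) e₁∈H e₂∈H e₃∈H x∈e₁ x∈e₂ x∈e₃ n₁₂ n₁₃ n₂₃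
    with other-end x∈e₁ | other-end x∈e₂ | other-end x∈e₃
  ... | o₁ , s₁ | o₂ , s₂ | o₃ , s₃ =
    circuit-degree C (at s₁ e₁∈H) (at s₂ e₂∈H) (at s₃ e₃∈H)
      (λ { refl → distinct-resp n₁₂ (SameEdge-sym s₁) (SameEdge-sym s₂) (inj₁ (refl , refl)) })
      (λ { refl → distinct-resp n₁₃ (SameEdge-sym s₁) (SameEdge-sym s₃) (inj₁ (refl , refl)) })
      (λ { refl → distinct-resp n₂₃ (SameEdge-sym s₂) (SameEdge-sym s₃) (inj₁ (refl , refl)) })
    where
    at : ∀ {x o e} → SameEdge (x , o) e → InE H e → InE H (x , o)
    at s = InE-resp H (consec-sym {H = H} E) (SameEdge-sym s)

module _ {n : ℕ} (F C D : Sub n) where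

  CircuitMeeting : Set
  CircuitMeeting = IsCircuit C × IsCircuit D
    × ∃[ u ] ∃[ v ] ∃[ w ] (PathSeq (C ∩ D) (u ∷ v ∷ w ∷ []) × InV F v × deg F v ≡ 1)

  PathMeeting : Set
  PathMeeting = IsPath C × IsPath D
    × ∃[ a ] ∃[ b ] ∃[ c ] ∃[ d ]
        (EndEdge C (a , b) × EndEdge C (c , d)
         × EndEdge D (a , b) × EndEdge D (c , d)
         × (∀ x → EndOf x (a , b) → ¬ EndOf x (c , d))
         × (∀ x → InV (C ∩ D) x ⇔ (EndOf x (a , b) ⊎ EndOf x (c , d)))
         × (∀ x y → InE (C ∩ D) (x , y)
              ⇔ (SameEdge (x , y) (a , b) ⊎ SameEdge (x , y) (c , d)))
         × (∀ x → InV C x → vs F x ≡ false)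
         × (∀ x → InV D x → vs F x ≡ false))

module Members {n m} {G F : Sub n} {𝒞 : Fin m → Sub n} (fw : Framework G F 𝒞) where
  open Framework fw

  C-sym : ∀ k {u v} → InE (𝒞 k) (u , v) → InE (𝒞 k) (v , u)
  C-sym k {u} {v} uv∈C = trans (proj₂ (proj₂ (proj₂ (𝒞-sub k))) v u) uv∈C

  C-ends : ∀ k {x e} → InE (𝒞 k) e → EndOf x e → InV (𝒞 k) x
  C-ends k {e = a , b} e∈C (inj₁ refl) = proj₁ (proj₂ (proj₂ (𝒞-sub k))) a b e∈C
  C-ends k {e = a , b} e∈C (inj₂ refl) = proj₁ (proj₂ (proj₂ (𝒞-sub k))) b a (C-sym k e∈C)

  C-loopless : ∀ k {u} → ¬ InE (𝒞 k) (u , u)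
  C-loopless k {u} uu∈C =
    true≢false (trans (sym (proj₁ (∧-true⁻ (proj₁ (proj₂ (𝒞-sub k)) u u uu∈C)))) (proj₂ (proj₂ simple) u))

  circuit-F-unique : ∀ k → IsCircuit (𝒞 k) → ∀ {x y} →
    InV (𝒞 k) x → InV F x → InV (𝒞 k) y → InV F y → y ≡ x
  circuit-F-unique k circ x∈C x∈F y∈C y∈F =
    countF-≤1-unique _ (proj₁ (proj₁ (f5 k) circ)) (∧-true⁺ y∈C y∈F) (∧-true⁺ x∈C x∈F)

  CircuitTwins : Fin m → Edge n → Edge n → Set
  CircuitTwins k e f = IsCircuit (𝒞 k) × (∃[ x ] (EndOf x e × EndOf x f × InV F x))
    × (∀ k′ → IsPath (𝒞 k′) → ∀ x → (EndOf x e ⊎ EndOf x f) → vs (𝒞 k′) x ≡ false)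

  PathTwins : Fin m → Edge n → Edge n → Set
  PathTwins k e f = IsPath (𝒞 k) × EndEdge (𝒞 k) e × EndEdge (𝒞 k) f
    × (∀ x → InV (𝒞 k) x → vs F x ≡ false)

  -- (F6) for a member containing both twinned edges: its third alternative needs f ∉ 𝒞 k
  twin-shape : ∀ {e f} → Twinned G F 𝒞 e f → ∀ k → InE (𝒞 k) e → InE (𝒞 k) f →
    CircuitTwins k e f ⊎ PathTwins k e f
  twin-shape {f = c , d} tw k e∈C f∈C with proj₂ (f6 _ _ tw k e∈C)
  ... | inj₁ (_ , circ , common , no-path)            = inj₁ (circ , common , no-path)
  ... | inj₂ (inj₁ (_ , path , e-end , f-end , no-F)) = inj₂ (path , e-end , f-end , no-F)
  ... | inj₂ (inj₂ (f∉C , _))                         = contradiction (trans (sym f∈C) f∉C) true≢false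

  circuit-twins-avoid-paths : ∀ {k l e f} → CircuitTwins k e f → IsPath (𝒞 l) → ¬ InE (𝒞 l) e
  circuit-twins-avoid-paths {l = l} {e = a , b} (_ , _ , no-path) path e∈C =
    true≢false (trans (sym (C-ends l e∈C (inj₁ refl))) (no-path l path a (inj₁ (inj₁ refl))))

  circuit-twins-closed : ∀ {k e f g} → CircuitTwins k e f →
    InE (𝒞 k) e → InE (𝒞 k) f → InE (𝒞 k) g → ¬ SameEdge e f → Twinned G F 𝒞 e g → ¬ SameEdge f g → ⊥
  circuit-twins-closed {k} CT@(circ , (x , x∈e , x∈f , x∈F) , _) e∈C f∈C g∈C e≢f tw f≢g
    with twin-shape tw k e∈C g∈C
  ... | inj₂ (path , _) = circuit-twins-avoid-paths CT path e∈C
  ... | inj₁ (_ , (x′ , x′∈e , x′∈g , x′∈F) , _)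
    with circuit-F-unique k circ (C-ends k e∈C x∈e) x∈F (C-ends k e∈C x′∈e) x′∈F
  ...   | refl = circuit-three-edges circ e∈C f∈C g∈C x∈e x∈f x′∈g e≢f (proj₁ tw) f≢g

  path-twins-closed : ∀ {k e f g} → PathTwins k e f →
    InE (𝒞 k) e → InE (𝒞 k) g → ¬ SameEdge e f → Twinned G F 𝒞 e g → ¬ SameEdge f g → ⊥
  path-twins-closed {k} (path , e-end , f-end , _) e∈C g∈C e≢f tw f≢g with twin-shape tw k e∈C g∈C
  ... | inj₁ CT                  = circuit-twins-avoid-paths CT path e∈C
  ... | inj₂ (_ , _ , g-end , _) = at-most-two-end-edges e-end f-end g-end e≢f (proj₁ tw) f≢g

module Intersection {n m} {G F : Sub n} {𝒞 : Fin m → Sub n} (fw : Framework G F 𝒞)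
                    (i j : Fin m) (i≢j : Distinct G F 𝒞 i j) where
  open Framework fw
  open Members fw

  X : Sub n
  X = 𝒞 i ∩ 𝒞 j

  X-left : ∀ {e} → InE X e → InE (𝒞 i) e
  X-left {a , b} e∈X = proj₁ (∧-true⁻ {es (𝒞 i) a b} e∈X)

  X-right : ∀ {e} → InE X e → InE (𝒞 j) e
  X-right {a , b} e∈X = proj₂ (∧-true⁻ {es (𝒞 i) a b} e∈X)

  X-sym : ∀ {u v} → InE X (u , v) → InE X (v , u)
  X-sym uv∈X = ∧-true⁺ (C-sym i (X-left uv∈X)) (C-sym j (X-right uv∈X))

  X-ends : ∀ {x e} → InE X e → EndOf x e → InV X x
  X-ends e∈X x∈e = ∧-true⁺ (C-ends i (X-left e∈X) x∈e) (C-ends j (X-right e∈X) x∈e)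

  X-vertex-left : ∀ {y} → InV X y → InV (𝒞 i) y
  X-vertex-left {y} y∈X = proj₁ (∧-true⁻ {vs (𝒞 i) y} y∈X)

  twinned-in-X : ∀ {e f} → InE X e → InE X f → ¬ SameEdge e f → Twinned G F 𝒞 e f
  twinned-in-X e∈X f∈X e≢f = e≢f , i , j , i≢j , X-left e∈X , X-left f∈X , X-right e∈X , X-right f∈X

  X-vertex : ∀ {e y} → InE X e → InV X y → (∃[ z ] InE X (y , z)) ⊎ InV F y
  X-vertex {a , b} e∈X y∈X with f3 i j i≢j _ y∈X
  ... | inj₂ edge-or-F = edge-or-F
  ... | inj₁ single    = ⊥-elim (C-loopless i (subst (λ w → InE (𝒞 i) (a , w)) b≡a (X-left e∈X)))
    where
    b≡a = trans (single b (X-ends e∈X (inj₂ refl))) (sym (single a (X-ends e∈X (inj₁ refl))))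

  only-two : ∀ {e f} → (∀ {g} → InE X g → ¬ SameEdge e g → ¬ SameEdge f g → ⊥) →
    ∀ s t → InE X (s , t) → SameEdge (s , t) e ⊎ SameEdge (s , t) f
  only-two {e} {f} no-third s t st∈X with SameEdge? (s , t) e | SameEdge? (s , t) f
  ... | yes st≡e | _        = inj₁ st≡e
  ... | no _     | yes st≡f = inj₂ st≡f
  ... | no st≢e  | no st≢f  =
    ⊥-elim (no-third st∈X (λ e≡st → st≢e (SameEdge-sym e≡st)) (λ f≡st → st≢f (SameEdge-sym f≡st)))

  module TwoEdges {e f : Edge n} (e∈X : InE X e) (f∈X : InE X f)
                  (covered : ∀ s t → InE X (s , t) → SameEdge (s , t) e ⊎ SameEdge (s , t) f) where

    edgeCount-X : edgeCount X ≤ 2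
    edgeCount-X = edgeCount-≤ X (e ∷ f ∷ []) λ s t st∈X → Sum.[ here , (λ s≡f → there (here s≡f)) ] (covered s t st∈X)

    edges-X : ∀ s t → InE X (s , t) ⇔ (SameEdge (s , t) e ⊎ SameEdge (s , t) f)
    edges-X s t = covered s t , Sum.[ (λ s≡e → InE-resp X X-sym (SameEdge-sym s≡e) e∈X)
                                    , (λ s≡f → InE-resp X X-sym (SameEdge-sym s≡f) f∈X) ]

    vertices-X : (∀ y → InV X y → InV F y → EndOf y e ⊎ EndOf y f) →
      ∀ y → InV X y ⇔ (EndOf y e ⊎ EndOf y f)
    vertices-X F-ends y = to , Sum.[ X-ends e∈X , X-ends f∈X ]
      where
      to : InV X y → EndOf y e ⊎ EndOf y f
      to y∈X with X-vertex e∈X y∈X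
      ... | inj₂ y∈F = F-ends y y∈X y∈F
      ... | inj₁ (z , yz∈X) = Sum.map (λ s → EndOf-resp s (inj₁ refl)) (λ s → EndOf-resp s (inj₁ refl)) (covered y z yz∈X)

  circuit-case : ∀ {e f} → InE X e → InE X f → ¬ SameEdge e f →
    CircuitTwins i e f → IsCircuit (𝒞 j) → edgeCount X ≤ 2 × CircuitMeeting F (𝒞 i) (𝒞 j)
  circuit-case {e} {f} e∈X f∈X e≢f CT@(circᵢ , (x , x∈e , x∈f , x∈F) , _) circⱼ =
    edgeCount-X , circᵢ , circⱼ , o₁ , x , o₂ ,
    cherry s₁ s₂ (λ o₁≡x → no-loop s₁ e∈X (sym o₁≡x)) (no-loop s₂ f∈X) o₁≢o₂ (vertices-X F-ends) edges-X ,
    x∈F , proj₂ (proj₁ (f5 i) circᵢ) x (∧-true⁺ x∈𝒞ᵢ x∈F)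
    where
    x∈𝒞ᵢ = C-ends i (X-left e∈X) x∈e
    no-third : ∀ {g} → InE X g → ¬ SameEdge e g → ¬ SameEdge f g → ⊥
    no-third g∈X e≢g = circuit-twins-closed CT (X-left e∈X) (X-left f∈X) (X-left g∈X) e≢f (twinned-in-X e∈X g∈X e≢g)
    open TwoEdges e∈X f∈X (only-two no-third)
    F-ends : ∀ y → InV X y → InV F y → EndOf y e ⊎ EndOf y f
    F-ends y y∈X y∈F
      rewrite circuit-F-unique i circᵢ x∈𝒞ᵢ x∈F (X-vertex-left y∈X) y∈F = inj₁ x∈e
    o₁ = proj₁ (other-end x∈e)
    s₁ = proj₂ (other-end x∈e)
    o₂ = proj₁ (other-end x∈f)
    s₂ = proj₂ (other-end x∈f)
    no-loop : ∀ {o g} → SameEdge (x , o) g → InE X g → x ≢ o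
    no-loop s g∈X refl = C-loopless i (InE-resp (𝒞 i) (C-sym i) (SameEdge-sym s) (X-left g∈X))
    o₁≢o₂ : o₁ ≢ o₂
    o₁≢o₂ o₁≡o₂ = e≢f (SameEdge-trans (SameEdge-sym s₁) (subst (λ o → SameEdge (x , o) f) (sym o₁≡o₂) s₂))

  path-case : ∀ {a b c d} → InE X (a , b) → InE X (c , d) → ¬ SameEdge (a , b) (c , d) →
    PathTwins i (a , b) (c , d) → PathTwins j (a , b) (c , d) → edgeCount X ≤ 2 × PathMeeting F (𝒞 i) (𝒞 j)
  path-case {a} {b} {c} {d} e∈X f∈X e≢f PT@(pathᵢ , e-endᵢ , f-endᵢ , no-Fᵢ) (pathⱼ , e-endⱼ , f-endⱼ , no-Fⱼ) =
    edgeCount-X , pathᵢ , pathⱼ , a , b , c , d , e-endᵢ , f-endᵢ , e-endⱼ , f-endⱼ ,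
    (λ x → end-edges-disjoint e-endᵢ f-endᵢ e≢f (proj₁ (proj₂ (f1 i)))) ,
    vertices-X F-ends , edges-X , no-Fᵢ , no-Fⱼ
    where
    no-third : ∀ {g} → InE X g → ¬ SameEdge (a , b) g → ¬ SameEdge (c , d) g → ⊥
    no-third g∈X e≢g = path-twins-closed PT (X-left e∈X) (X-left g∈X) e≢f (twinned-in-X e∈X g∈X e≢g)
    open TwoEdges e∈X f∈X (only-two no-third)
    F-ends : ∀ y → InV X y → InV F y → EndOf y (a , b) ⊎ EndOf y (c , d)
    F-ends y y∈X y∈F = contradiction (trans (sym y∈F) (no-Fᵢ y (X-vertex-left y∈X))) true≢false

  two-edges : ∀ {e f} → InE X e → InE X f → ¬ SameEdge e f →
    edgeCount X ≤ 2 × (CircuitMeeting F (𝒞 i) (𝒞 j) ⊎ PathMeeting F (𝒞 i) (𝒞 j))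
  two-edges {a , b} {c , d} e∈X f∈X e≢f
    with twin-shape (twinned-in-X e∈X f∈X e≢f) i (X-left e∈X) (X-left f∈X)
       | twin-shape (twinned-in-X e∈X f∈X e≢f) j (X-right e∈X) (X-right f∈X)
  ... | inj₁ CTᵢ | inj₁ (circⱼ , _) = map₂ inj₁ (circuit-case e∈X f∈X e≢f CTᵢ circⱼ)
  ... | inj₂ PTᵢ | inj₂ PTⱼ         = map₂ inj₂ (path-case e∈X f∈X e≢f PTᵢ PTⱼ)
  ... | inj₁ CTᵢ | inj₂ (pathⱼ , _) = ⊥-elim (circuit-twins-avoid-paths CTᵢ pathⱼ (X-right e∈X))
  ... | inj₂ (pathᵢ , _) | inj₁ CTⱼ = ⊥-elim (circuit-twins-avoid-paths CTⱼ pathᵢ (X-left e∈X))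

theorem3p2 : ∀ {n m} (G F : Sub n) (𝒞 : Fin m → Sub n) →
    Framework G F 𝒞 → ∀ i j → Distinct G F 𝒞 i j →
    edgeCount (𝒞 i ∩ 𝒞 j) ≤ 2
    × (edgeCount (𝒞 i ∩ 𝒞 j) ≡ 2 →
        (IsCircuit (𝒞 i) × IsCircuit (𝒞 j)
          × ∃[ u ] ∃[ v ] ∃[ w ] (PathSeq (𝒞 i ∩ 𝒞 j) (u ∷ v ∷ w ∷ [])
               × InV F v × deg F v ≡ 1))
        ⊎ (IsPath (𝒞 i) × IsPath (𝒞 j)
          × ∃[ a ] ∃[ b ] ∃[ c ] ∃[ d ]
              (EndEdge (𝒞 i) (a , b) × EndEdge (𝒞 i) (c , d)
               × EndEdge (𝒞 j) (a , b) × EndEdge (𝒞 j) (c , d)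
               × (∀ x → EndOf x (a , b) → ¬ EndOf x (c , d))
               × (∀ x → InV (𝒞 i ∩ 𝒞 j) x ⇔ (EndOf x (a , b) ⊎ EndOf x (c , d)))
               × (∀ x y → InE (𝒞 i ∩ 𝒞 j) (x , y)
                    ⇔ (SameEdge (x , y) (a , b) ⊎ SameEdge (x , y) (c , d)))
               × (∀ x → InV (𝒞 i) x → vs F x ≡ false)
               × (∀ x → InV (𝒞 j) x → vs F x ≡ false))))
theorem3p2 G F 𝒞 fw i j i≢j with at-most-one-or-two-edges (𝒞 i ∩ 𝒞 j)
... | inj₁ ≤1 = ≤-trans ≤1 (n≤1+n 1) , λ ≡2 → contradiction (subst (_≤ 1) ≡2 ≤1) λ { (s≤s ()) }
... | inj₂ (e , f , e∈X , f∈X , e≢f) =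
  map₂ (λ outcome _ → outcome) (Intersection.two-edges fw i j i≢j e∈X f∈X e≢f)
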